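{- Suppose $G$ is a connected graph containing a cycle, with $V(G)=\{v_1,\ldots,v_n\}$, and let $T$ be a spanning tree of $G$. Let $\mathcal{F}\subseteq\mathbb{F}_3[x_1,\ldots,x_n]$ be the set of polynomials $$\mathcal{F}=\Big\{\Big[\prod_{v_iv_j\in E(T),\, j>i}(x_i-x_j)\Big]\Big[\prod_{v_iv_j\in E(G)\setminus E(T),\, j>i}(x_i+b_{i,j}x_j)\Big]\;:\;\text{each } b_{i,j}\in\{ -1,1\}\Big\}.$$ If for each $f\in\mathcal{F}$ there exists $(t_1,\ldots,t_n)\in\{0,1,2\}^n$ such that the coefficient of $\prod_{i=1}^n x_i^{t_i}$ in $f$ is nonzero, then $\chi_{DP}(G)\le 3$.
   Context: All graphs are finite and simple; $\mathbb{F}_3$ is the field with three elements. A cover of a graph $G$ is a pair $\mathcal{H}=(L,H)$ where $H$ is a graph and $L:V(G)\to\mathcal{P}(V(H))$ satisfies: (1) $\{L(u)\}$ partitions $V(H)$; (2) each $H[L(u)]$ is complete; (3) if $E_H(L(u),L(v))\neq\emptyset$ then $u=v$ or $uv\in E(G)$; (4) if $uv\in E(G)$ then $E_H(L(u),L(v))$ is a matching (possibly empty). An $\mathcal{H}$-coloring is an independent set of $H$ of size $|V(G)|$. The cover is $m$-fold if $|L(u)|=m$ for all $u$. $\chi_{DP}(G)$ is the least $m\in\mathbb{N}$ such that $G$ has an $\mathcal{H}$-coloring for every $m$-fold cover $\mathcal{H}$. -}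

module Defs where

open import Data.Nat using (ℕ; zero; suc; _+_; _≤_; _<ᵇ_)
open import Data.Nat.DivMod using (_mod_)
open import Data.Nat.Properties using () renaming (_≟_ to _≟ℕ_)
open import Data.Fin using (Fin; toℕ; inject₁; fromℕ) renaming (zero to fz; suc to fs)
open import Data.Fin.Subset using (Subset; _∈_; ∣_∣)
open import Data.Bool using (Bool; true; false; if_then_else_)
open import Data.Product using (Σ; ∃; _×_; _,_)
open import Data.Sum using (_⊎_)
open import Data.List using (List; []; _∷_; _++_; concatMap; foldr; map)
open import Data.List.Base using (allFin)
open import Data.Vec using (Vec; tabulate; zipWith; replicate)
import Data.Vec.Properties as VecP
open import Data.Fin.Properties using () renaming (_≟_ to _≟F_)
open import Relation.Nullary using (¬_; does)
open import Relation.Binary.PropositionalEquality using (_≡_)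
open import Function.Definitions using (Injective)

record Graph (n : ℕ) : Set where
  field
    Adj    : Fin n → Fin n → Bool
    sym    : ∀ u v → Adj u v ≡ Adj v u
    irrefl : ∀ u → Adj u u ≡ false

open Graph public

E : ∀ {n} → Graph n → Fin n → Fin n → Set
E G u v = Adj G u v ≡ true

data Reach {n : ℕ} (G : Graph n) : Fin n → Fin n → Set where
  here : ∀ {u} → Reach G u u
  step : ∀ {u v w} → E G u v → Reach G v w → Reach G u w

Connected : ∀ {n} → Graph n → Set
Connected G = ∀ u v → Reach G u v

HasCycle : ∀ {n} → Graph n → Set
HasCycle {n} G =
  Σ ℕ λ k → Σ (Fin (suc (suc (suc k))) → Fin n) λ c →
    Injective _≡_ _≡_ c
    × (∀ (i : Fin (suc (suc k))) → E G (c (inject₁ i)) (c (fs i)))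
    × E G (c (fromℕ (suc (suc k)))) (c fz)

SubgraphOf : ∀ {n} → Graph n → Graph n → Set
SubgraphOf T G = ∀ u v → E T u v → E G u v

IsSpanningTree : ∀ {n} → Graph n → Graph n → Set
IsSpanningTree T G = SubgraphOf T G × Connected T × ¬ HasCycle T

record Cover {n : ℕ} (G : Graph n) : Set where
  field
    N : ℕ
    H : Graph N
    L : Fin n → Subset N
    covers   : ∀ (x : Fin N) → ∃ λ u → x ∈ L u
    disjoint : ∀ (x : Fin N) u v → x ∈ L u → x ∈ L v → u ≡ v
    clique   : ∀ u (x y : Fin N) → x ∈ L u → y ∈ L u → ¬ x ≡ y → E H x y
    cross    : ∀ u v (x y : Fin N) → x ∈ L u → y ∈ L v → E H x y → u ≡ v ⊎ E G u v
    matchingˡ : ∀ u v → E G u v → ∀ (x y y′ : Fin N) → x ∈ L u → y ∈ L v → y′ ∈ L v →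
                E H x y → E H x y′ → y ≡ y′
    matchingʳ : ∀ u v → E G u v → ∀ (x x′ y : Fin N) → x ∈ L u → x′ ∈ L u → y ∈ L v →
                E H x y → E H x′ y → x ≡ x′

open Cover public

IsFold : ∀ {n} {G : Graph n} → Cover G → ℕ → Set
IsFold C m = ∀ u → ∣ L C u ∣ ≡ m

HasColoring : ∀ {n} {G : Graph n} → Cover G → Set
HasColoring {n} C =
  Σ (Subset (N C)) λ S → ∣ S ∣ ≡ n
    × (∀ x y → x ∈ S → y ∈ S → Adj (H C) x y ≡ false)

DPColorable : ∀ {n} → Graph n → ℕ → Set
DPColorable G m = ∀ (C : Cover G) → IsFold C m → HasColoring C

-- χ_DP(G) ≤ k  (the least m with DPColorable G m is at most k)
χDP≤ : ∀ {n} → Graph n → ℕ → Set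
χDP≤ G k = Σ ℕ λ m → m ≤ k × DPColorable G m

F3 : Set
F3 = Fin 3

_+₃_ : F3 → F3 → F3
a +₃ b = (toℕ a + toℕ b) mod 3

_*₃_ : F3 → F3 → F3
a *₃ b = (Data.Nat._*_ (toℕ a) (toℕ b)) mod 3

zero₃ one₃ minusOne₃ : F3
zero₃ = fz
one₃ = fs fz
minusOne₃ = fs (fs fz)

Mono : ℕ → Set
Mono n = Vec ℕ n

-- a polynomial is a formal F₃-linear combination of monomials
-- (a finite list of terms; equal monomials are summed in coeff)
Poly : ℕ → Set
Poly n = List (F3 × Mono n)

coeff : ∀ {n} → Poly n → Mono n → F3
coeff p t = foldr (λ { (c , m) acc → if does (VecP.≡-dec _≟ℕ_ m t) then c +₃ acc else acc }) zero₃ p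

_*P_ : ∀ {n} → Poly n → Poly n → Poly n
p *P q = concatMap (λ { (c , m) → map (λ { (d , m′) → (c *₃ d , zipWith _+_ m m′) }) q }) p

_+P_ : ∀ {n} → Poly n → Poly n → Poly n
p +P q = p ++ q

scale : ∀ {n} → F3 → Poly n → Poly n
scale c p = map (λ { (d , m) → (c *₃ d , m) }) p

oneP : ∀ {n} → Poly n
oneP {n} = (one₃ , replicate n 0) ∷ []

var : ∀ {n} → Fin n → Poly n
var {n} i = (one₃ , tabulate (λ k → if does (k ≟F i) then 1 else 0)) ∷ []


pairs : (n : ℕ) → List (Fin n × Fin n)
pairs n = concatMap (λ i → concatMap (λ j → if toℕ i <ᵇ toℕ j then (i , j) ∷ [] else []) (allFin n)) (allFin n)

-- b_{i,j} ∈ {-1,1} encoded as a Bool (true ↦ 1, false ↦ -1)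
sign : Bool → F3
sign true = one₃
sign false = minusOne₃

factor : ∀ {n} → Graph n → Graph n → (Fin n → Fin n → Bool) → Fin n → Fin n → Poly n
factor G T b i j =
  if Adj T i j then var i +P scale minusOne₃ (var j)
  else if Adj G i j then var i +P scale (sign (b i j)) (var j)
  else oneP

fPoly : ∀ {n} → Graph n → Graph n → (Fin n → Fin n → Bool) → Poly n
fPoly {n} G T b = foldr (λ { (i , j) acc → factor G T b i j *P acc }) oneP (pairs n)

-- Identify each list L(v) of a 3-fold cover with 𝔽₃. A matching between two copies of 𝔽₃ lies in the
-- graph of an affine map y = ±x + c, so a choice a ∈ 𝔽₃ⁿ is a DP-colouring as soon as, for every edge
-- vᵢvⱼ with i < j, an affine form aᵢ + βᵢⱼ aⱼ + κᵢⱼ does not vanish. Multiplying the vertices by signs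
-- switched along the spanning tree T (possible as T is connected and acyclic) makes βᵢⱼ = -1 on every
-- tree edge, so the leading form of the product of these affine forms is a member f of 𝓕. A monomial
-- with exponents at most 2 and nonzero coefficient in f is detected by summing against ∏ aᵢ^(2-tᵢ)
-- over 𝔽₃ⁿ (the Combinatorial Nullstellensatz), so the product is nonzero at some a.

module Submission where

open import Defs
open import Data.Nat using (ℕ)
open import Data.Fin using (Fin; toℕ)
open import Data.Bool using (Bool)
open import Data.Vec using (Vec; map)
open import Data.Product using (∃)
open import Relation.Nullary using (¬_)
open import Relation.Binary.PropositionalEquality using (_≡_)

open import Algebra.Bundles using (CommutativeSemiring)
open import Algebra.Structures using (IsCommutativeSemiring)
open import Data.Bool using (true; false; not; _xor_; if_then_else_)
import Data.Bool.Properties as Boolₚ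
open import Data.Empty using (⊥; ⊥-elim)
open import Data.Fin using (inject₁; fromℕ) renaming (zero to fz; suc to fs)
open import Data.Fin.Properties using (all?; any?; _≟_)
import Data.Fin.Properties as Finₚ
open import Data.Fin.Subset using (Subset; ⁅_⁆; _∪_; ∣_∣) renaming (⊥ to ∅; _∈_ to _∈ₛ_; _∉_ to _∉ₛ_)
import Data.Fin.Subset.Properties as Subsetₚ
open import Data.List using (List; []; _∷_; _++_; [_]; foldr; length)
import Data.List as List
import Data.List.Properties as Listₚ
open import Data.List.Membership.Propositional using (_∈_)
open import Data.List.Membership.Propositional.Properties using (∈-∃++; ∈-lookup; ∈-concatMap⁺; ∈-allFin)
open import Data.List.Relation.Unary.All as All using (All; []; _∷_)
import Data.List.Relation.Unary.All.Properties as Allₚ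
open import Data.List.Relation.Unary.AllPairs using ([]; _∷_)
open import Data.List.Relation.Unary.Any as Any using (here; there)
open import Data.List.Relation.Unary.Unique.Propositional using (Unique)
open import Data.Nat using (zero; suc; _+_; _∸_; _≤_; _<_; _<ᵇ_; z≤n; s≤s)
import Data.Nat.Induction as ℕᵢ
import Data.Nat.Properties as ℕₚ
open import Data.Product using (Σ; _×_; _,_; proj₁; proj₂; ∃₂; uncurry)
open import Data.Sum using (_⊎_; inj₁; inj₂; [_,_]′)
open import Data.Vec using ([]; _∷_; here; there; zipWith; replicate)
import Data.Vec as Vec
import Data.Vec.Properties as Vecₚ
open import Data.Vec.Relation.Binary.Pointwise.Inductive using (Pointwise; []; _∷_)
open import Function using (_∘_; _⟨_⟩_; Equivalence)
open import Function.Definitions using (Injective)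
open import Induction.WellFounded using (Acc; acc)
open import Relation.Binary.Definitions using (Tri; tri<; tri≈; tri>)
open import Relation.Binary.PropositionalEquality as ≡
  using (_≢_; refl; trans; cong; cong₂; subst; subst₂; isEquivalence; module ≡-Reasoning)
import Relation.Binary.PropositionalEquality.Properties as ≡ₚ
open import Relation.Nullary using (Dec; yes; no; does)
open import Relation.Nullary.Decidable using (from-yes; map′; ¬?; _×-dec_; _⊎-dec_; _→-dec_)
open import Relation.Unary using (Decidable)

open import Algebra.Properties.CommutativeSemigroup ℕₚ.+-commutativeSemigroup
  using () renaming (interchange to ℕ-+-interchange)

F3-isCommutativeSemiring : IsCommutativeSemiring _≡_ _+₃_ _*₃_ zero₃ one₃
F3-isCommutativeSemiring = record
  { isSemiring = record
    { isSemiringWithoutAnnihilatingZero = record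
      { +-isCommutativeMonoid = record
        { isMonoid = record
          { isSemigroup = record
            { isMagma = record { isEquivalence = isEquivalence ; ∙-cong = cong₂ _+₃_ }
            ; assoc = from-yes (all? λ a → all? λ b → all? λ c → (a +₃ b) +₃ c ≟ a +₃ (b +₃ c))
            }
          ; identity = from-yes (all? λ a → zero₃ +₃ a ≟ a) , from-yes (all? λ a → a +₃ zero₃ ≟ a)
          }
        ; comm = from-yes (all? λ a → all? λ b → a +₃ b ≟ b +₃ a)
        }
      ; *-cong = cong₂ _*₃_
      ; *-assoc = from-yes (all? λ a → all? λ b → all? λ c → (a *₃ b) *₃ c ≟ a *₃ (b *₃ c))
      ; *-identity = from-yes (all? λ a → one₃ *₃ a ≟ a) , from-yes (all? λ a → a *₃ one₃ ≟ a)
      ; distrib = from-yes (all? λ a → all? λ b → all? λ c → a *₃ (b +₃ c) ≟ (a *₃ b) +₃ (a *₃ c))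
                , from-yes (all? λ a → all? λ b → all? λ c → (b +₃ c) *₃ a ≟ (b *₃ a) +₃ (c *₃ a))
      }
    ; zero = from-yes (all? λ a → zero₃ *₃ a ≟ zero₃) , from-yes (all? λ a → a *₃ zero₃ ≟ zero₃)
    }
  ; *-comm = from-yes (all? λ a → all? λ b → a *₃ b ≟ b *₃ a)
  }

𝔽₃ : CommutativeSemiring _ _
𝔽₃ = record { isCommutativeSemiring = F3-isCommutativeSemiring }

open CommutativeSemiring 𝔽₃ using
  ( +-assoc; +-identityˡ; +-identityʳ; *-assoc; *-comm; *-identityˡ; *-identityʳ
  ; distribˡ; distribʳ; zeroˡ; zeroʳ; semiring; *-commutativeSemigroup; +-commutativeSemigroup )
open import Algebra.Properties.CommutativeSemigroup *-commutativeSemigroup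
  using () renaming (interchange to *-interchange)
open import Algebra.Properties.CommutativeSemigroup +-commutativeSemigroup
  using () renaming (interchange to +-interchange)
open import Algebra.Properties.Semiring.Exp semiring using (_^_; ^-homo-*)

*-≢0 : ∀ a b → a ≢ zero₃ → b ≢ zero₃ → a *₃ b ≢ zero₃
*-≢0 = from-yes (all? λ a → all? λ b → ¬? (a ≟ zero₃) →-dec ¬? (b ≟ zero₃) →-dec ¬? (a *₃ b ≟ zero₃))

*-≢0⇒≢0ˡ : ∀ a b → a *₃ b ≢ zero₃ → a ≢ zero₃
*-≢0⇒≢0ˡ a b ab≢0 refl = ab≢0 (zeroˡ b)

*-≢0⇒≢0ʳ : ∀ a b → a *₃ b ≢ zero₃ → b ≢ zero₃
*-≢0⇒≢0ʳ a b ab≢0 refl = ab≢0 (zeroʳ a)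

^-≢0 : ∀ a n → a ≢ zero₃ → a ^ n ≢ zero₃
^-≢0 a zero a≢0 = λ ()
^-≢0 a (suc n) a≢0 = *-≢0 a (a ^ n) a≢0 (^-≢0 a n a≢0)

∀-Bool? : {P : Bool → Set} → Decidable P → Dec (∀ b → P b)
∀-Bool? P? = map′ (λ { (p , q) true → p ; (p , q) false → q }) (λ h → h true , h false) (P? true ×-dec P? false)

∃-Bool? : {P : Bool → Set} → Decidable P → Dec (∃ P)
∃-Bool? P? = map′ [ (true ,_) , (false ,_) ]′ (λ { (true , p) → inj₁ p ; (false , p) → inj₂ p })
                  (P? true ⊎-dec P? false)

-- With xᵥ = sign σᵥ * aᵥ, a conflict xⱼ = sign ε * xᵢ + c becomes a zero of an affine form in a;
-- note sign (not (ε xor (σᵢ xor σⱼ))) = - sign ε * sign σᵢ * sign σⱼ.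
sign-affine⇒linear : ∀ ε σᵢ σⱼ (aᵢ aⱼ c : F3) →
  sign σⱼ *₃ aⱼ ≡ (sign ε *₃ (sign σᵢ *₃ aᵢ)) +₃ c →
  (aᵢ +₃ (sign (not (ε xor (σᵢ xor σⱼ))) *₃ aⱼ)) +₃ (sign ε *₃ (sign σᵢ *₃ c)) ≡ zero₃
sign-affine⇒linear = from-yes
  (∀-Bool? λ ε → ∀-Bool? λ σᵢ → ∀-Bool? λ σⱼ → all? λ aᵢ → all? λ aⱼ → all? λ c →
   (sign σⱼ *₃ aⱼ ≟ (sign ε *₃ (sign σᵢ *₃ aᵢ)) +₃ c) →-dec
   ((aᵢ +₃ (sign (not (ε xor (σᵢ xor σⱼ))) *₃ aⱼ)) +₃ (sign ε *₃ (sign σᵢ *₃ c)) ≟ zero₃))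

Rel₃ : Set
Rel₃ = F3 → F3 → Bool

IsMatching : Rel₃ → Set
IsMatching R = (∀ x y y′ → R x y ≡ true → R x y′ ≡ true → y ≡ y′)
             × (∀ x x′ y → R x y ≡ true → R x′ y ≡ true → x ≡ x′)

WithinAffine : Bool → F3 → Rel₃ → Set
WithinAffine ε c R = ∀ x y → R x y ≡ true → y ≡ (sign ε *₃ x) +₃ c

isMatching? : ∀ R → Dec (IsMatching R)
isMatching? R =
  (all? λ x → all? λ y → all? λ y′ → (R x y Boolₚ.≟ true) →-dec (R x y′ Boolₚ.≟ true) →-dec (y ≟ y′)) ×-dec
  (all? λ x → all? λ x′ → all? λ y → (R x y Boolₚ.≟ true) →-dec (R x′ y Boolₚ.≟ true) →-dec (x ≟ x′))

withinAffine? : ∀ ε c R → Dec (WithinAffine ε c R)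
withinAffine? ε c R = all? λ x → all? λ y → (R x y Boolₚ.≟ true) →-dec (y ≟ (sign ε *₃ x) +₃ c)

table : (b₀₀ b₀₁ b₀₂ b₁₀ b₁₁ b₁₂ b₂₀ b₂₁ b₂₂ : Bool) → Rel₃
table b₀₀ b₀₁ b₀₂ b₁₀ b₁₁ b₁₂ b₂₀ b₂₁ b₂₂ = λ
  { fz fz → b₀₀ ; fz (fs fz) → b₀₁ ; fz (fs (fs fz)) → b₀₂
  ; (fs fz) fz → b₁₀ ; (fs fz) (fs fz) → b₁₁ ; (fs fz) (fs (fs fz)) → b₁₂
  ; (fs (fs fz)) fz → b₂₀ ; (fs (fs fz)) (fs fz) → b₂₁ ; (fs (fs fz)) (fs (fs fz)) → b₂₂ }

tableOf : Rel₃ → Rel₃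
tableOf R = table (R fz fz) (R fz (fs fz)) (R fz (fs (fs fz)))
                  (R (fs fz) fz) (R (fs fz) (fs fz)) (R (fs fz) (fs (fs fz)))
                  (R (fs (fs fz)) fz) (R (fs (fs fz)) (fs fz)) (R (fs (fs fz)) (fs (fs fz)))

tableOf-correct : ∀ R x y → tableOf R x y ≡ R x y
tableOf-correct R fz fz = refl
tableOf-correct R fz (fs fz) = refl
tableOf-correct R fz (fs (fs fz)) = refl
tableOf-correct R (fs fz) fz = refl
tableOf-correct R (fs fz) (fs fz) = refl
tableOf-correct R (fs fz) (fs (fs fz)) = refl
tableOf-correct R (fs (fs fz)) fz = refl
tableOf-correct R (fs (fs fz)) (fs fz) = refl
tableOf-correct R (fs (fs fz)) (fs (fs fz)) = refl

IsMatching-resp : ∀ {R R′} → (∀ x y → R x y ≡ R′ x y) → IsMatching R → IsMatching R′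
IsMatching-resp R≡R′ (injˡ , injʳ) =
  (λ x y y′ r r′ → injˡ x y y′ (trans (R≡R′ x y) r) (trans (R≡R′ x y′) r′)) ,
  (λ x x′ y r r′ → injʳ x x′ y (trans (R≡R′ x y) r) (trans (R≡R′ x′ y) r′))

-- Opaque, so that using it never unfolds the 512-case check.
opaque
  table-matching⇒affine : ∀ b₀₀ b₀₁ b₀₂ b₁₀ b₁₁ b₁₂ b₂₀ b₂₁ b₂₂ →
    let R = table b₀₀ b₀₁ b₀₂ b₁₀ b₁₁ b₁₂ b₂₀ b₂₁ b₂₂ in IsMatching R → ∃₂ λ ε c → WithinAffine ε c R
  table-matching⇒affine = from-yes
    (∀-Bool? λ b₀₀ → ∀-Bool? λ b₀₁ → ∀-Bool? λ b₀₂ → ∀-Bool? λ b₁₀ → ∀-Bool? λ b₁₁ →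
     ∀-Bool? λ b₁₂ → ∀-Bool? λ b₂₀ → ∀-Bool? λ b₂₁ → ∀-Bool? λ b₂₂ →
     let R = table b₀₀ b₀₁ b₀₂ b₁₀ b₁₁ b₁₂ b₂₀ b₂₁ b₂₂ in
     isMatching? R →-dec ∃-Bool? λ ε → any? λ c → withinAffine? ε c R)

matching⇒affine : ∀ R → IsMatching R → ∃₂ λ ε c → WithinAffine ε c R
matching⇒affine R matching =
  let ε , c , within = table-matching⇒affine (R fz fz) (R fz (fs fz)) (R fz (fs (fs fz)))
                         (R (fs fz) fz) (R (fs fz) (fs fz)) (R (fs fz) (fs (fs fz)))
                         (R (fs (fs fz)) fz) (R (fs (fs fz)) (fs fz)) (R (fs (fs fz)) (fs (fs fz)))
                         (IsMatching-resp (λ x y → ≡.sym (tableOf-correct R x y)) matching)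
  in ε , c , λ x y r → within x y (trans (tableOf-correct R x y) r)

evalMono : ∀ {n} → Mono n → Vec F3 n → F3
evalMono [] [] = one₃
evalMono (k ∷ m) (x ∷ a) = (x ^ k) *₃ evalMono m a

evalP : ∀ {n} → Poly n → Vec F3 n → F3
evalP [] a = zero₃
evalP ((c , m) ∷ p) a = (c *₃ evalMono m a) +₃ evalP p a

evalMono-zipWith : ∀ {n} (m m′ : Mono n) a → evalMono (zipWith _+_ m m′) a ≡ evalMono m a *₃ evalMono m′ a
evalMono-zipWith [] [] [] = refl
evalMono-zipWith (k ∷ m) (k′ ∷ m′) (x ∷ a) =
  trans (cong₂ _*₃_ (^-homo-* x k k′) (evalMono-zipWith m m′ a))
        (*-interchange (x ^ k) (x ^ k′) (evalMono m a) (evalMono m′ a))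

evalMono-replicate-0 : ∀ {n} (a : Vec F3 n) → evalMono (replicate n 0) a ≡ one₃
evalMono-replicate-0 [] = refl
evalMono-replicate-0 {suc n} (x ∷ a) = trans (*-identityˡ (evalMono (replicate n 0) a)) (evalMono-replicate-0 a)

evalP-++ : ∀ {n} (p q : Poly n) a → evalP (p ++ q) a ≡ evalP p a +₃ evalP q a
evalP-++ [] q a = ≡.sym (+-identityˡ (evalP q a))
evalP-++ ((c , m) ∷ p) q a =
  trans (cong ((c *₃ evalMono m a) +₃_) (evalP-++ p q a))
        (≡.sym (+-assoc (c *₃ evalMono m a) (evalP p a) (evalP q a)))

*P-∷ : ∀ {n} c (m : Mono n) p q → ((c , m) ∷ p) *P q ≡ (((c , m) ∷ []) *P q) ++ (p *P q)
*P-∷ c m p q = cong (_++ (p *P q)) (≡.sym (Listₚ.++-identityʳ _))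

evalP-term-*P : ∀ {n} c (m : Mono n) q a → evalP (((c , m) ∷ []) *P q) a ≡ (c *₃ evalMono m a) *₃ evalP q a
evalP-term-*P c m [] a = ≡.sym (zeroʳ (c *₃ evalMono m a))
evalP-term-*P c m ((d , m′) ∷ q) a = begin
  ((c *₃ d) *₃ evalMono (zipWith _+_ m m′) a) +₃ evalP (((c , m) ∷ []) *P q) a
    ≡⟨ cong₂ _+₃_ (trans (cong ((c *₃ d) *₃_) (evalMono-zipWith m m′ a)) (*-interchange c d M M′))
                  (evalP-term-*P c m q a) ⟩
  ((c *₃ M) *₃ (d *₃ M′)) +₃ ((c *₃ M) *₃ evalP q a)
    ≡⟨ ≡.sym (distribˡ (c *₃ M) (d *₃ M′) (evalP q a)) ⟩
  (c *₃ M) *₃ evalP ((d , m′) ∷ q) a ∎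
  where
  open ≡-Reasoning
  M = evalMono m a
  M′ = evalMono m′ a

evalP-*P : ∀ {n} (p q : Poly n) a → evalP (p *P q) a ≡ evalP p a *₃ evalP q a
evalP-*P [] q a = ≡.sym (zeroˡ (evalP q a))
evalP-*P ((c , m) ∷ p) q a = begin
  evalP (((c , m) ∷ p) *P q) a
    ≡⟨ cong (λ r → evalP r a) (*P-∷ c m p q) ⟩
  evalP ((((c , m) ∷ []) *P q) ++ (p *P q)) a
    ≡⟨ evalP-++ (((c , m) ∷ []) *P q) (p *P q) a ⟩
  evalP (((c , m) ∷ []) *P q) a +₃ evalP (p *P q) a
    ≡⟨ cong₂ _+₃_ (evalP-term-*P c m q a) (evalP-*P p q a) ⟩
  ((c *₃ evalMono m a) *₃ evalP q a) +₃ (evalP p a *₃ evalP q a)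
    ≡⟨ ≡.sym (distribʳ (evalP q a) (c *₃ evalMono m a) (evalP p a)) ⟩
  evalP ((c , m) ∷ p) a *₃ evalP q a ∎
  where open ≡-Reasoning

deg : ∀ {n} → Mono n → ℕ
deg = Vec.sum

deg-zipWith : ∀ {n} (m m′ : Mono n) → deg (zipWith _+_ m m′) ≡ deg m + deg m′
deg-zipWith [] [] = refl
deg-zipWith (k ∷ m) (k′ ∷ m′) =
  trans (cong (k + k′ +_) (deg-zipWith m m′)) (ℕ-+-interchange k k′ (deg m) (deg m′))

deg-replicate-0 : ∀ n → deg (replicate n 0) ≡ 0
deg-replicate-0 zero = refl
deg-replicate-0 (suc n) = deg-replicate-0 n

DegreesSatisfy : ∀ {n} → (ℕ → Set) → Poly n → Set
DegreesSatisfy P p = All (λ term → P (deg (proj₂ term))) p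

Homogeneous : ∀ {n} → ℕ → Poly n → Set
Homogeneous d = DegreesSatisfy (_≡ d)

DegreeAtMost : ∀ {n} → ℕ → Poly n → Set
DegreeAtMost d = DegreesSatisfy (_≤ d)

DegreeBelow : ∀ {n} → ℕ → Poly n → Set
DegreeBelow d = DegreesSatisfy (_< d)

Homogeneous⇒AtMost : ∀ {n d} {p : Poly n} → Homogeneous d p → DegreeAtMost d p
Homogeneous⇒AtMost = All.map ℕₚ.≤-reflexive

Below⇒AtMost : ∀ {n d} {p : Poly n} → DegreeBelow d p → DegreeAtMost d p
Below⇒AtMost = All.map ℕₚ.<⇒≤

module _ {n : ℕ} {P Q R : ℕ → Set} (P∙Q⇒R : ∀ {i j} → P i → Q j → R (i + j)) where

  DegreesSatisfy-term-*P : ∀ c (m : Mono n) q → P (deg m) → DegreesSatisfy Q q →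
                           DegreesSatisfy R (((c , m) ∷ []) *P q)
  DegreesSatisfy-term-*P c m [] pm [] = []
  DegreesSatisfy-term-*P c m ((d , m′) ∷ q) pm (qm′ ∷ qq) =
    subst R (≡.sym (deg-zipWith m m′)) (P∙Q⇒R pm qm′) ∷ DegreesSatisfy-term-*P c m q pm qq

  DegreesSatisfy-*P : ∀ (p q : Poly n) → DegreesSatisfy P p → DegreesSatisfy Q q → DegreesSatisfy R (p *P q)
  DegreesSatisfy-*P [] q [] qq = []
  DegreesSatisfy-*P ((c , m) ∷ p) q (pm ∷ pp) qq = subst (DegreesSatisfy R) (≡.sym (*P-∷ c m p q))
    (Allₚ.++⁺ (DegreesSatisfy-term-*P c m q pm qq) (DegreesSatisfy-*P p q pp qq))

Homogeneous-*P : ∀ {n e d} (p q : Poly n) → Homogeneous e p → Homogeneous d q → Homogeneous (e + d) (p *P q)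
Homogeneous-*P {e = e} {d} = DegreesSatisfy-*P {P = _≡ e} {_≡ d} {_≡ e + d} (λ { refl refl → refl })

AtMost-*P-Below : ∀ {n e d} (p q : Poly n) → DegreeAtMost e p → DegreeBelow d q → DegreeBelow (e + d) (p *P q)
AtMost-*P-Below {e = e} {d} = DegreesSatisfy-*P {P = _≤ e} {_< d} {_< e + d} ℕₚ.+-mono-≤-<

Below-*P-AtMost : ∀ {n e d} (p q : Poly n) → DegreeBelow e p → DegreeAtMost d q → DegreeBelow (e + d) (p *P q)
Below-*P-AtMost {e = e} {d} = DegreesSatisfy-*P {P = _< e} {_≤ d} {_< e + d} ℕₚ.+-mono-<-≤

record LeadingForm {n} (d : ℕ) (f : Poly n) (φ : Vec F3 n → F3) : Set where
  field
    homogeneous     : Homogeneous d f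
    remainder       : Poly n
    remainder-below : DegreeBelow d remainder
    expansion       : ∀ a → φ a ≡ evalP f a +₃ evalP remainder a

open LeadingForm

LeadingForm-oneP : ∀ {n} → LeadingForm 0 (oneP {n}) (λ _ → one₃)
LeadingForm-oneP {n} = record
  { homogeneous = deg-replicate-0 n ∷ []
  ; remainder = []
  ; remainder-below = []
  ; expansion = λ a → ≡.sym (trans (+-identityʳ _) (trans (+-identityʳ _)
                        (trans (*-identityˡ _) (evalMono-replicate-0 a))))
  }

LeadingForm-+const : ∀ {n d} {p : Poly n} k → Homogeneous d p → k ≡ zero₃ ⊎ 0 < d →
                     LeadingForm d p (λ a → evalP p a +₃ k)
LeadingForm-+const k hom (inj₁ refl) = record
  { homogeneous = hom ; remainder = [] ; remainder-below = [] ; expansion = λ a → refl }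
LeadingForm-+const {n} {d} {p} k hom (inj₂ 0<d) = record
  { homogeneous = hom
  ; remainder = (k , replicate n 0) ∷ []
  ; remainder-below = subst (_< d) (≡.sym (deg-replicate-0 n)) 0<d ∷ []
  ; expansion = λ a → cong (evalP p a +₃_) (≡.sym (trans (+-identityʳ _)
                        (trans (cong (k *₃_) (evalMono-replicate-0 a)) (*-identityʳ k))))
  }

LeadingForm-* : ∀ {n e d} {h f : Poly n} {ψ φ} → LeadingForm e h ψ → LeadingForm d f φ →
                LeadingForm (e + d) (h *P f) (λ a → ψ a *₃ φ a)
LeadingForm-* {e = e} {d} {h} {f} {ψ} {φ} lh lf = record
  { homogeneous = Homogeneous-*P h f (homogeneous lh) (homogeneous lf)
  ; remainder = (h *P r) ++ (r′ *P (f ++ r))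
  ; remainder-below = Allₚ.++⁺
      (AtMost-*P-Below h r (Homogeneous⇒AtMost (homogeneous lh)) (remainder-below lf))
      (Below-*P-AtMost r′ (f ++ r) (remainder-below lh)
        (Allₚ.++⁺ (Homogeneous⇒AtMost (homogeneous lf)) (Below⇒AtMost (remainder-below lf))))
  ; expansion = expand
  }
  where
  r = remainder lf
  r′ = remainder lh
  expand : ∀ a → ψ a *₃ φ a ≡ evalP (h *P f) a +₃ evalP ((h *P r) ++ (r′ *P (f ++ r))) a
  expand a = begin
    ψ a *₃ φ a                                     ≡⟨ cong₂ _*₃_ (expansion lh a) (expansion lf a) ⟩
    (hₐ +₃ r′ₐ) *₃ (fₐ +₃ rₐ)                       ≡⟨ distribʳ (fₐ +₃ rₐ) hₐ r′ₐ ⟩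
    (hₐ *₃ (fₐ +₃ rₐ)) +₃ (r′ₐ *₃ (fₐ +₃ rₐ))         ≡⟨ cong (_+₃ (r′ₐ *₃ (fₐ +₃ rₐ))) (distribˡ hₐ fₐ rₐ) ⟩
    ((hₐ *₃ fₐ) +₃ (hₐ *₃ rₐ)) +₃ (r′ₐ *₃ (fₐ +₃ rₐ)) ≡⟨ +-assoc (hₐ *₃ fₐ) (hₐ *₃ rₐ) (r′ₐ *₃ (fₐ +₃ rₐ)) ⟩
    (hₐ *₃ fₐ) +₃ ((hₐ *₃ rₐ) +₃ (r′ₐ *₃ (fₐ +₃ rₐ)))
      ≡⟨ ≡.sym (cong₂ _+₃_ (evalP-*P h f a) (trans (evalP-++ (h *P r) (r′ *P (f ++ r)) a)
           (cong₂ _+₃_ (evalP-*P h r a) (trans (evalP-*P r′ (f ++ r) a) (cong (r′ₐ *₃_) (evalP-++ f r a)))))) ⟩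
    evalP (h *P f) a +₃ evalP ((h *P r) ++ (r′ *P (f ++ r))) a ∎
    where
    open ≡-Reasoning
    hₐ = evalP h a
    fₐ = evalP f a
    rₐ = evalP r a
    r′ₐ = evalP r′ a

module _ {n} {I : Set} (φ : I → Vec F3 n → F3) where

  ∏ᶠ : List I → Vec F3 n → F3
  ∏ᶠ is a = foldr (λ i x → φ i a *₃ x) one₃ is

  ∏ᶠ-≢0 : ∀ is a → ∏ᶠ is a ≢ zero₃ → ∀ {i} → i ∈ is → φ i a ≢ zero₃
  ∏ᶠ-≢0 (i ∷ is) a ≢0 (here refl) = *-≢0⇒≢0ˡ (φ i a) (∏ᶠ is a) ≢0
  ∏ᶠ-≢0 (j ∷ is) a ≢0 (there i∈is) = ∏ᶠ-≢0 is a (*-≢0⇒≢0ʳ (φ j a) (∏ᶠ is a) ≢0) i∈is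

∏ᴾ : ∀ {n} {I : Set} → (I → Poly n) → List I → Poly n
∏ᴾ f = foldr (λ i p → f i *P p) oneP

LeadingForm-∏ : ∀ {n} {I : Set} {f : I → Poly n} {φ} → (∀ i → ∃ λ d → LeadingForm d (f i) (φ i)) →
                ∀ is → ∃ λ d → LeadingForm d (∏ᴾ f is) (∏ᶠ φ is)
LeadingForm-∏ leading [] = 0 , LeadingForm-oneP
LeadingForm-∏ leading (i ∷ is) with leading i | LeadingForm-∏ leading is
... | e , lᵢ | d , lᵢₛ = e + d , LeadingForm-* lᵢ lᵢₛ

unitMono : ∀ {n} → Fin n → Mono n
unitMono i = Vec.tabulate (λ k → if does (k ≟ i) then 1 else 0)

tabulate-0 : ∀ {n} (f : Fin n → ℕ) → (∀ k → f k ≡ 0) → Vec.tabulate f ≡ replicate n 0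
tabulate-0 {zero} f f≡0 = refl
tabulate-0 {suc n} f f≡0 = cong₂ _∷_ (f≡0 fz) (tabulate-0 (f ∘ fs) (f≡0 ∘ fs))

unitMono-fz : ∀ n → unitMono {suc n} fz ≡ 1 ∷ replicate n 0
unitMono-fz n = cong (1 ∷_) (tabulate-0 _ (λ _ → refl))

deg-unitMono : ∀ {n} (i : Fin n) → deg (unitMono i) ≡ 1
deg-unitMono {suc n} fz = trans (cong deg (unitMono-fz n)) (cong suc (deg-replicate-0 n))
deg-unitMono {suc n} (fs i) = deg-unitMono i

evalMono-unitMono : ∀ {n} (i : Fin n) a → evalMono (unitMono i) a ≡ Vec.lookup a i
evalMono-unitMono {suc n} fz (x ∷ a) = begin
  evalMono (unitMono fz) (x ∷ a)       ≡⟨ cong (λ m → evalMono m (x ∷ a)) (unitMono-fz n) ⟩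
  (x *₃ one₃) *₃ evalMono (replicate n 0) a ≡⟨ cong₂ _*₃_ (*-identityʳ x) (evalMono-replicate-0 a) ⟩
  x *₃ one₃                            ≡⟨ *-identityʳ x ⟩
  x ∎
  where open ≡-Reasoning
evalMono-unitMono {suc n} (fs i) (x ∷ a) = trans (*-identityˡ (evalMono (unitMono i) a)) (evalMono-unitMono i a)

linearForm : ∀ {n} → Fin n → F3 → Fin n → Poly n
linearForm i s j = var i +P scale s (var j)

Homogeneous-linearForm : ∀ {n} (i : Fin n) s j → Homogeneous 1 (linearForm i s j)
Homogeneous-linearForm i s j = deg-unitMono i ∷ deg-unitMono j ∷ []

evalP-linearForm : ∀ {n} (i : Fin n) s j a →
                   evalP (linearForm i s j) a ≡ Vec.lookup a i +₃ (s *₃ Vec.lookup a j)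
evalP-linearForm i s j a = cong₂ _+₃_
  (trans (*-identityˡ (evalMono (unitMono i) a)) (evalMono-unitMono i a))
  (trans (+-identityʳ _) (cong₂ _*₃_ (*-identityʳ s) (evalMono-unitMono j a)))

-- Detecting a coefficient by summing over 𝔽₃ⁿ

Σ₃ : (F3 → F3) → F3
Σ₃ g = g zero₃ +₃ (g one₃ +₃ g minusOne₃)

Σ₃-cong : ∀ {g h} → (∀ x → g x ≡ h x) → Σ₃ g ≡ Σ₃ h
Σ₃-cong g≗h = cong₂ _+₃_ (g≗h zero₃) (cong₂ _+₃_ (g≗h one₃) (g≗h minusOne₃))

Σ₃-+ : ∀ g h → Σ₃ (λ x → g x +₃ h x) ≡ Σ₃ g +₃ Σ₃ h
Σ₃-+ g h = trans (cong ((g zero₃ +₃ h zero₃) +₃_) (+-interchange (g one₃) (h one₃) (g minusOne₃) (h minusOne₃)))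
                 (+-interchange (g zero₃) (h zero₃) (g one₃ +₃ g minusOne₃) (h one₃ +₃ h minusOne₃))

Σ₃-*ˡ : ∀ k g → Σ₃ (λ x → k *₃ g x) ≡ k *₃ Σ₃ g
Σ₃-*ˡ k g = trans (cong ((k *₃ g zero₃) +₃_) (≡.sym (distribˡ k (g one₃) (g minusOne₃))))
                  (≡.sym (distribˡ k (g zero₃) (g one₃ +₃ g minusOne₃)))

Σ₃-*ʳ : ∀ k g → Σ₃ (λ x → g x *₃ k) ≡ Σ₃ g *₃ k
Σ₃-*ʳ k g = trans (Σ₃-cong (λ x → *-comm (g x) k)) (trans (Σ₃-*ˡ k g) (*-comm k (Σ₃ g)))

Σ₃-≢0 : ∀ g → Σ₃ g ≢ zero₃ → ∃ λ x → g x ≢ zero₃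
Σ₃-≢0 g Σ≢0 with g zero₃ ≟ zero₃ | g one₃ ≟ zero₃ | g minusOne₃ ≟ zero₃
... | no g₀≢0 | _ | _ = zero₃ , g₀≢0
... | yes _ | no g₁≢0 | _ = one₃ , g₁≢0
... | yes _ | yes _ | no g₂≢0 = minusOne₃ , g₂≢0
... | yes g₀≡0 | yes g₁≡0 | yes g₂≡0 = ⊥-elim (Σ≢0 (cong₂ _+₃_ g₀≡0 (cong₂ _+₃_ g₁≡0 g₂≡0)))

Σⁿ : ∀ n → (Vec F3 n → F3) → F3
Σⁿ zero g = g []
Σⁿ (suc n) g = Σ₃ (λ x → Σⁿ n (λ a → g (x ∷ a)))

Σⁿ-cong : ∀ n {g h} → (∀ a → g a ≡ h a) → Σⁿ n g ≡ Σⁿ n h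
Σⁿ-cong zero g≗h = g≗h []
Σⁿ-cong (suc n) g≗h = Σ₃-cong (λ x → Σⁿ-cong n (λ a → g≗h (x ∷ a)))

Σⁿ-+ : ∀ n g h → Σⁿ n (λ a → g a +₃ h a) ≡ Σⁿ n g +₃ Σⁿ n h
Σⁿ-+ zero g h = refl
Σⁿ-+ (suc n) g h = trans (Σ₃-cong (λ x → Σⁿ-+ n (λ a → g (x ∷ a)) (λ a → h (x ∷ a))))
                         (Σ₃-+ (λ x → Σⁿ n (λ a → g (x ∷ a))) (λ x → Σⁿ n (λ a → h (x ∷ a))))

Σⁿ-*ˡ : ∀ n k g → Σⁿ n (λ a → k *₃ g a) ≡ k *₃ Σⁿ n g
Σⁿ-*ˡ zero k g = refl
Σⁿ-*ˡ (suc n) k g = trans (Σ₃-cong (λ x → Σⁿ-*ˡ n k (λ a → g (x ∷ a)))) (Σ₃-*ˡ k (λ x → Σⁿ n (λ a → g (x ∷ a))))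

Σⁿ-0 : ∀ n → Σⁿ n (λ _ → zero₃) ≡ zero₃
Σⁿ-0 zero = refl
Σⁿ-0 (suc n) = Σ₃-cong (λ _ → Σⁿ-0 n)

Σⁿ-≢0 : ∀ n g → Σⁿ n g ≢ zero₃ → ∃ λ a → g a ≢ zero₃
Σⁿ-≢0 zero g Σ≢0 = [] , Σ≢0
Σⁿ-≢0 (suc n) g Σ≢0 with Σ₃-≢0 (λ x → Σⁿ n (λ a → g (x ∷ a))) Σ≢0
... | x , Σₓ≢0 with Σⁿ-≢0 n (λ a → g (x ∷ a)) Σₓ≢0
... | a , gₓₐ≢0 = x ∷ a , gₓₐ≢0

-- The weight ∏ aᵢ^(2 - tᵢ) selects the coefficient of the monomial ∏ xᵢ^tᵢ.
weight : ∀ {n} → Vec F3 n → Vec F3 n → F3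
weight [] [] = one₃
weight (t ∷ ts) (x ∷ a) = (x ^ (2 ∸ toℕ t)) *₃ weight ts a

weightedSum : ∀ {n} → Vec F3 n → (Vec F3 n → F3) → F3
weightedSum {n} t g = Σⁿ n (λ a → g a *₃ weight t a)

moment₁ : ℕ → F3 → F3
moment₁ k t = Σ₃ (λ x → (x ^ k) *₃ (x ^ (2 ∸ toℕ t)))

moment : ∀ {n} → Mono n → Vec F3 n → F3
moment [] [] = one₃
moment (k ∷ m) (t ∷ ts) = moment₁ k t *₃ moment m ts

moment₁-≢0 : ∀ k t → moment₁ k t ≢ zero₃ → toℕ t ≤ k
moment₁-≢0 k fz ≢0 = z≤n
moment₁-≢0 zero (fs fz) ≢0 = ⊥-elim (≢0 refl)
moment₁-≢0 (suc k) (fs fz) ≢0 = s≤s z≤n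
moment₁-≢0 zero (fs (fs fz)) ≢0 = ⊥-elim (≢0 refl)
moment₁-≢0 (suc zero) (fs (fs fz)) ≢0 = ⊥-elim (≢0 refl)
moment₁-≢0 (suc (suc k)) (fs (fs fz)) ≢0 = s≤s (s≤s z≤n)

moment₁-diagonal : ∀ t → moment₁ (toℕ t) t ≡ minusOne₃
moment₁-diagonal fz = refl
moment₁-diagonal (fs fz) = refl
moment₁-diagonal (fs (fs fz)) = refl

weightedSum-evalMono : ∀ {n} (m : Mono n) t → weightedSum t (evalMono m) ≡ moment m t
weightedSum-evalMono [] [] = refl
weightedSum-evalMono {suc n} (k ∷ m) (t ∷ ts) = begin
  Σ₃ (λ x → Σⁿ n (λ a → ((x ^ k) *₃ evalMono m a) *₃ ((x ^ (2 ∸ toℕ t)) *₃ weight ts a)))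
    ≡⟨ Σ₃-cong (λ x → Σⁿ-cong n (λ a → *-interchange (x ^ k) (evalMono m a) (x ^ (2 ∸ toℕ t)) (weight ts a))) ⟩
  Σ₃ (λ x → Σⁿ n (λ a → ((x ^ k) *₃ (x ^ (2 ∸ toℕ t))) *₃ (evalMono m a *₃ weight ts a)))
    ≡⟨ Σ₃-cong (λ x → Σⁿ-*ˡ n ((x ^ k) *₃ (x ^ (2 ∸ toℕ t))) (λ a → evalMono m a *₃ weight ts a)) ⟩
  Σ₃ (λ x → ((x ^ k) *₃ (x ^ (2 ∸ toℕ t))) *₃ weightedSum ts (evalMono m))
    ≡⟨ Σ₃-*ʳ (weightedSum ts (evalMono m)) (λ x → (x ^ k) *₃ (x ^ (2 ∸ toℕ t))) ⟩
  moment₁ k t *₃ weightedSum ts (evalMono m)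
    ≡⟨ cong (moment₁ k t *₃_) (weightedSum-evalMono m ts) ⟩
  moment₁ k t *₃ moment m ts ∎
  where open ≡-Reasoning

moment-≢0 : ∀ {n} (m : Mono n) t → moment m t ≢ zero₃ → Pointwise _≤_ (map toℕ t) m
moment-≢0 [] [] ≢0 = []
moment-≢0 (k ∷ m) (t ∷ ts) ≢0 = moment₁-≢0 k t (*-≢0⇒≢0ˡ (moment₁ k t) (moment m ts) ≢0)
                              ∷ moment-≢0 m ts (*-≢0⇒≢0ʳ (moment₁ k t) (moment m ts) ≢0)

moment-diagonal : ∀ {n} (t : Vec F3 n) → moment (map toℕ t) t ≡ minusOne₃ ^ n
moment-diagonal [] = refl
moment-diagonal (t ∷ ts) = cong₂ _*₃_ (moment₁-diagonal t) (moment-diagonal ts)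

deg-mono-≤ : ∀ {n} {m m′ : Mono n} → Pointwise _≤_ m m′ → deg m ≤ deg m′
deg-mono-≤ [] = z≤n
deg-mono-≤ (k≤k′ ∷ m≤m′) = ℕₚ.+-mono-≤ k≤k′ (deg-mono-≤ m≤m′)

deg-≡⇒≡ : ∀ {n} {m m′ : Mono n} → Pointwise _≤_ m m′ → deg m′ ≡ deg m → m′ ≡ m
deg-≡⇒≡ [] _ = refl
deg-≡⇒≡ {m = k ∷ m} {k′ ∷ m′} (k≤k′ ∷ m≤m′) deg≡ = cong₂ _∷_ k′≡k (deg-≡⇒≡ m≤m′ rest≡)
  where
  k′≡k : k′ ≡ k
  k′≡k = ℕₚ.≤-antisym (ℕₚ.+-cancelʳ-≤ (deg m′) k′ k
           (ℕₚ.≤-trans (ℕₚ.≤-reflexive deg≡) (ℕₚ.+-monoʳ-≤ k (deg-mono-≤ m≤m′)))) k≤k′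
  rest≡ : deg m′ ≡ deg m
  rest≡ = ℕₚ.+-cancelˡ-≡ k (deg m′) (deg m) (trans (cong (_+ deg m′) (≡.sym k′≡k)) deg≡)

weightedSum-∷ : ∀ {n} c (m : Mono n) p t →
  weightedSum t (evalP ((c , m) ∷ p)) ≡ (c *₃ moment m t) +₃ weightedSum t (evalP p)
weightedSum-∷ {n} c m p t = begin
  Σⁿ n (λ a → ((c *₃ evalMono m a) +₃ evalP p a) *₃ weight t a)
    ≡⟨ Σⁿ-cong n (λ a → trans (distribʳ (weight t a) (c *₃ evalMono m a) (evalP p a))
                              (cong (_+₃ (evalP p a *₃ weight t a)) (*-assoc c (evalMono m a) (weight t a)))) ⟩
  Σⁿ n (λ a → (c *₃ (evalMono m a *₃ weight t a)) +₃ (evalP p a *₃ weight t a))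
    ≡⟨ Σⁿ-+ n (λ a → c *₃ (evalMono m a *₃ weight t a)) (λ a → evalP p a *₃ weight t a) ⟩
  Σⁿ n (λ a → c *₃ (evalMono m a *₃ weight t a)) +₃ weightedSum t (evalP p)
    ≡⟨ cong (_+₃ weightedSum t (evalP p)) (trans (Σⁿ-*ˡ n c (λ a → evalMono m a *₃ weight t a))
                                                 (cong (c *₃_) (weightedSum-evalMono m t))) ⟩
  (c *₃ moment m t) +₃ weightedSum t (evalP p) ∎
  where open ≡-Reasoning

weightedSum-[] : ∀ {n} (t : Vec F3 n) → weightedSum t (evalP []) ≡ zero₃
weightedSum-[] {n} t = trans (Σⁿ-cong n (λ a → zeroˡ (weight t a))) (Σⁿ-0 n)

coeff-≢0⇒deg : ∀ {n d} (f : Poly n) m → Homogeneous d f → coeff f m ≢ zero₃ → deg m ≡ d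
coeff-≢0⇒deg [] m [] ≢0 = ⊥-elim (≢0 refl)
coeff-≢0⇒deg ((c , m′) ∷ f) m (deg≡ ∷ hom) ≢0 with Vecₚ.≡-dec ℕₚ._≟_ m′ m
... | yes refl = deg≡
... | no _ = coeff-≢0⇒deg f m hom ≢0

weightedSum-homogeneous : ∀ {n} (f : Poly n) t → Homogeneous (deg (map toℕ t)) f →
  weightedSum t (evalP f) ≡ (minusOne₃ ^ n) *₃ coeff f (map toℕ t)
weightedSum-homogeneous {n} [] t [] = trans (weightedSum-[] t) (≡.sym (zeroʳ (minusOne₃ ^ n)))
weightedSum-homogeneous {n} ((c , m) ∷ f) t (deg≡ ∷ hom)
  rewrite weightedSum-∷ c m f t | weightedSum-homogeneous f t hom with Vecₚ.≡-dec ℕₚ._≟_ m (map toℕ t)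
... | yes refl = trans (cong (λ μ → (c *₃ μ) +₃ ((minusOne₃ ^ n) *₃ coeff f (map toℕ t))) (moment-diagonal t))
                       (trans (cong (_+₃ ((minusOne₃ ^ n) *₃ coeff f (map toℕ t))) (*-comm c (minusOne₃ ^ n)))
                              (≡.sym (distribˡ (minusOne₃ ^ n) c (coeff f (map toℕ t)))))
... | no m≢t with moment m t ≟ zero₃
...   | yes μ≡0 =
  trans (cong (λ μ → (c *₃ μ) +₃ rest) μ≡0) (trans (cong (_+₃ rest) (zeroʳ c)) (+-identityˡ rest))
  where rest = (minusOne₃ ^ n) *₃ coeff f (map toℕ t)
...   | no μ≢0 = ⊥-elim (m≢t (deg-≡⇒≡ (moment-≢0 m t μ≢0) deg≡))

weightedSum-below : ∀ {n} (r : Poly n) t → DegreeBelow (deg (map toℕ t)) r → weightedSum t (evalP r) ≡ zero₃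
weightedSum-below [] t [] = weightedSum-[] t
weightedSum-below ((c , m) ∷ r) t (deg< ∷ below) rewrite weightedSum-∷ c m r t | weightedSum-below r t below
  with moment m t ≟ zero₃
... | yes μ≡0 = trans (+-identityʳ (c *₃ moment m t)) (trans (cong (c *₃_) μ≡0) (zeroʳ c))
... | no μ≢0 = ⊥-elim (ℕₚ.<⇒≱ deg< (deg-mono-≤ (moment-≢0 m t μ≢0)))

LeadingForm-nonvanishing : ∀ {n d} {f : Poly n} {φ} → LeadingForm d f φ →
  ∀ t → coeff f (map toℕ t) ≢ zero₃ → ∃ λ a → φ a ≢ zero₃
LeadingForm-nonvanishing {n} {d} {f} {φ} lf t coeff≢0 = a , *-≢0⇒≢0ˡ (φ a) (weight t a) φw≢0
  where
  d≡deg : d ≡ deg (map toℕ t)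
  d≡deg = ≡.sym (coeff-≢0⇒deg f (map toℕ t) (homogeneous lf) coeff≢0)
  weightedSum≡ : weightedSum t φ ≡ (minusOne₃ ^ n) *₃ coeff f (map toℕ t)
  weightedSum≡ = begin
    weightedSum t φ
      ≡⟨ Σⁿ-cong n (λ a → trans (cong (_*₃ weight t a) (expansion lf a))
                                (distribʳ (weight t a) (evalP f a) (evalP (remainder lf) a))) ⟩
    Σⁿ n (λ a → (evalP f a *₃ weight t a) +₃ (evalP (remainder lf) a *₃ weight t a))
      ≡⟨ Σⁿ-+ n (λ a → evalP f a *₃ weight t a) (λ a → evalP (remainder lf) a *₃ weight t a) ⟩
    weightedSum t (evalP f) +₃ weightedSum t (evalP (remainder lf))
      ≡⟨ cong₂ _+₃_ (weightedSum-homogeneous f t (subst (λ e → Homogeneous e f) d≡deg (homogeneous lf)))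
                    (weightedSum-below (remainder lf) t
                      (subst (λ e → DegreeBelow e (remainder lf)) d≡deg (remainder-below lf))) ⟩
    ((minusOne₃ ^ n) *₃ coeff f (map toℕ t)) +₃ zero₃
      ≡⟨ +-identityʳ ((minusOne₃ ^ n) *₃ coeff f (map toℕ t)) ⟩
    (minusOne₃ ^ n) *₃ coeff f (map toℕ t) ∎
    where open ≡-Reasoning
  witness = Σⁿ-≢0 n (λ a → φ a *₃ weight t a)
    (λ Σ≡0 → *-≢0 (minusOne₃ ^ n) (coeff f (map toℕ t)) (^-≢0 minusOne₃ n (λ ())) coeff≢0
                  (trans (≡.sym weightedSum≡) Σ≡0))
  a = proj₁ witness
  φw≢0 = proj₂ witness

-- Switching signs along a spanning tree

E-irrefl : ∀ {n} (G : Graph n) u → ¬ E G u u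
E-irrefl G u uu with trans (≡.sym uu) (Graph.irrefl G u)
... | ()


data Walk {n} (G : Graph n) (x : Fin n) : List (Fin n) → Set where
  [] : Walk G x []
  _∷_ : ∀ {v vs} → E G x v → Walk G v vs → Walk G x (v ∷ vs)

end : ∀ {n} → Fin n → List (Fin n) → Fin n
end x [] = x
end x (v ∷ vs) = end v vs

end-++ : ∀ {n} (x : Fin n) A B → end x (A ++ B) ≡ end (end x A) B
end-++ x [] B = refl
end-++ x (v ∷ A) B = end-++ v A B

end-splice : ∀ {n} (x : Fin n) P y L C → end x P ≡ y → end y L ≡ y → end x (P ++ (L ++ C)) ≡ end x (P ++ C)
end-splice x P y L C endP endL rewrite end-++ x P (L ++ C) | end-++ x P C | endP | end-++ y L C | endL = refl

module _ {n} {G : Graph n} where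

  Walk-++ : ∀ {x} A {B} → Walk G x A → Walk G (end x A) B → Walk G x (A ++ B)
  Walk-++ [] [] wB = wB
  Walk-++ (v ∷ A) (xv ∷ wA) wB = xv ∷ Walk-++ A wA wB

  Walk-++⁻ : ∀ {x} A {B} → Walk G x (A ++ B) → Walk G x A × Walk G (end x A) B
  Walk-++⁻ [] w = [] , w
  Walk-++⁻ (v ∷ A) (xv ∷ w) with Walk-++⁻ A w
  ... | wA , wB = xv ∷ wA , wB

  Walk-splice : ∀ {x} P {y} L {C} → end x P ≡ y → end y L ≡ y →
                Walk G x (P ++ (L ++ C)) → Walk G y L × Walk G x (P ++ C)
  Walk-splice P L refl endL walk with Walk-++⁻ P walk
  ... | walkP , walkLC with Walk-++⁻ L walkLC
  ... | walkL , walkC = walkL , Walk-++ P walkP (subst (λ z → Walk G z _) endL walkC)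

  Reach⇒Walk : ∀ {u w} → Reach G u w → ∃ λ vs → Walk G u vs × end u vs ≡ w
  Reach⇒Walk here = [] , [] , refl
  Reach⇒Walk (step {v = v} uv reach) with Reach⇒Walk reach
  ... | vs , walk , end≡ = v ∷ vs , uv ∷ walk , end≡

  Walk-lookup : ∀ {x} vs → Walk G x vs → ∀ (i : Fin (length vs)) →
                E G (List.lookup (x ∷ vs) (inject₁ i)) (List.lookup (x ∷ vs) (fs i))
  Walk-lookup (v ∷ vs) (xv ∷ w) fz = xv
  Walk-lookup (v ∷ vs) (xv ∷ w) (fs i) = Walk-lookup vs w i

lookup-last : ∀ {n} (x : Fin n) vs → List.lookup (x ∷ vs) (fromℕ (length vs)) ≡ end x vs
lookup-last x [] = refl
lookup-last x (v ∷ vs) = lookup-last v vs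

module _ {A : Set} where

  length-∷ʳ-positive : ∀ (xs : List A) y → 0 < length (xs ++ [ y ])
  length-∷ʳ-positive xs y = subst (0 <_) (≡.sym (Listₚ.length-++-sucʳ xs y [])) (s≤s z≤n)

  length-++-middle : ∀ (P L C : List A) → length (P ++ (L ++ C)) ≡ length P + (length L + length C)
  length-++-middle P L C = trans (Listₚ.length-++ P) (cong (length P +_) (Listₚ.length-++ L))

  length-<-++-middle : ∀ (P L C : List A) → 0 < length P → length L < length (P ++ (L ++ C))
  length-<-++-middle P L C P>0 = subst (length L <_) (≡.sym (length-++-middle P L C))
    (ℕₚ.≤-<-trans (ℕₚ.m≤m+n (length L) (length C)) (ℕₚ.m<n+m (length L + length C) P>0))

  length-<-drop-middle : ∀ (P L C : List A) → 0 < length L → length (P ++ C) < length (P ++ (L ++ C))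
  length-<-drop-middle P L C L>0 = subst₂ _<_ (≡.sym (Listₚ.length-++ P)) (≡.sym (length-++-middle P L C))
    (ℕₚ.+-monoʳ-< (length P) (ℕₚ.m<n+m (length C) L>0))

Repeats : ∀ {n} → List (Fin n) → Set
Repeats {n} vs = Σ (List (Fin n)) λ A → Σ (Fin n) λ y → Σ (List (Fin n)) λ B → ∃ λ C →
  vs ≡ (A ++ [ y ]) ++ ((B ++ [ y ]) ++ C)

unique-or-repeats : ∀ {n} (vs : List (Fin n)) → Unique vs ⊎ Repeats vs
unique-or-repeats [] = inj₁ []
unique-or-repeats (x ∷ vs) with Any.any? (x ≟_) vs
... | yes x∈vs with ∈-∃++ x∈vs
...   | B , C , refl = inj₂ ([] , x , B , C , cong (x ∷_) (≡.sym (Listₚ.++-assoc B [ x ] C)))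
unique-or-repeats (x ∷ vs) | no x∉vs with unique-or-repeats vs
... | inj₁ unique = inj₁ (Allₚ.¬Any⇒All¬ vs x∉vs ∷ unique)
... | inj₂ (A , y , B , C , refl) = inj₂ (x ∷ A , y , B , C , refl)

Unique-lookup-injective : ∀ {n} {vs : List (Fin n)} → Unique vs →
                          ∀ i j → List.lookup vs i ≡ List.lookup vs j → i ≡ j
Unique-lookup-injective (x∉ ∷ unique) fz fz eq = refl
Unique-lookup-injective (x∉ ∷ unique) fz (fs j) eq = ⊥-elim (All.lookup x∉ (∈-lookup j) eq)
Unique-lookup-injective (x∉ ∷ unique) (fs i) fz eq = ⊥-elim (All.lookup x∉ (∈-lookup i) (≡.sym eq))
Unique-lookup-injective (x∉ ∷ unique) (fs i) (fs j) eq = cong fs (Unique-lookup-injective unique i j eq)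

xor≡false⇒≡ : ∀ {x y} → x xor y ≡ false → x ≡ y
xor≡false⇒≡ {true} {true} _ = refl
xor≡false⇒≡ {false} {false} _ = refl

xor-cancel : ∀ x y z → x xor (y xor z) ≡ false → x xor z ≡ y
xor-cancel x y z eq = begin
  x xor z             ≡⟨ cong (_xor z) (xor≡false⇒≡ {x} {y xor z} eq) ⟩
  (y xor z) xor z     ≡⟨ Boolₚ.xor-assoc y z z ⟩
  y xor (z xor z)     ≡⟨ cong (y xor_) (Boolₚ.xor-same z) ⟩
  y xor false         ≡⟨ Boolₚ.xor-identityʳ y ⟩
  y ∎
  where open ≡-Reasoning

module Parity {n} (e : Fin n → Fin n → Bool) (e-sym : ∀ u v → e u v ≡ e v u) where

  parity : Fin n → List (Fin n) → Bool
  parity x [] = false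
  parity x (v ∷ vs) = e x v xor parity v vs

  parity-++ : ∀ x A B → parity x (A ++ B) ≡ parity x A xor parity (end x A) B
  parity-++ x [] B = refl
  parity-++ x (v ∷ A) B =
    trans (cong (e x v xor_) (parity-++ v A B)) (≡.sym (Boolₚ.xor-assoc (e x v) (parity v A) _))

  parity-splice : ∀ x P y L C → end x P ≡ y → end y L ≡ y → parity y L ≡ false →
                  parity x (P ++ (L ++ C)) ≡ parity x (P ++ C)
  parity-splice x P y L C endP endL loop
    rewrite parity-++ x P (L ++ C) | parity-++ x P C | endP | parity-++ y L C | endL | loop = refl

  module _ {T : Graph n} (acyclic : ¬ HasCycle T) where

    -- A closed walk through a repeated vertex splits into two shorter closed walks; without repetitions
    -- it has length at most 2 or is a cycle.
    closedWalk-parity : ∀ x vs → Walk T x vs → end x vs ≡ x → parity x vs ≡ false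
    closedWalk-parity x vs = go x vs (ℕᵢ.<-wellFounded (length vs))
      where
      go : ∀ x vs → Acc _<_ (length vs) → Walk T x vs → end x vs ≡ x → parity x vs ≡ false
      go x vs (acc shorter) walk closed with unique-or-repeats vs
      ... | inj₂ (A , y , B , C , refl) =
        trans (parity-splice x pre y loop C endPre endLoop loop-even)
              (go x (pre ++ C) (shorter (length-<-drop-middle pre loop C (length-∷ʳ-positive B y))) (proj₂ walks)
                  (trans (≡.sym (end-splice x pre y loop C endPre endLoop)) closed))
        where
        pre = A ++ [ y ]
        loop = B ++ [ y ]
        endPre = end-++ x A [ y ]
        endLoop = end-++ y B [ y ]
        walks = Walk-splice pre loop endPre endLoop walk
        loop-even : parity y loop ≡ false
        loop-even = go y loop (shorter (length-<-++-middle pre loop C (length-∷ʳ-positive A y))) (proj₁ walks) endLoop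
      go x [] _ walk closed | inj₁ _ = refl
      go x (v ∷ []) _ (xv ∷ []) refl | inj₁ _ = ⊥-elim (E-irrefl T x xv)
      go x (v ∷ w ∷ []) _ (xv ∷ (vw ∷ [])) refl | inj₁ _ =
        trans (cong (e w v xor_) (trans (Boolₚ.xor-identityʳ (e v w)) (e-sym v w))) (Boolₚ.xor-same (e w v))
      go x (v ∷ w ∷ u ∷ vs) _ (xv ∷ walk) closed | inj₁ unique = ⊥-elim (acyclic cycle)
        where
        cycle : HasCycle T
        cycle = length vs , List.lookup (v ∷ w ∷ u ∷ vs) , (λ {i} {j} → Unique-lookup-injective unique i j)
              , Walk-lookup (w ∷ u ∷ vs) walk
              , subst (λ z → E T z v) (≡.sym (trans (lookup-last v (w ∷ u ∷ vs)) closed)) xv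

    closedWalk-++ : ∀ {x y} A B → Walk T x A → end x A ≡ y → Walk T y B → end y B ≡ x →
                    parity x A xor parity y B ≡ false
    closedWalk-++ {x} A B walkA refl walkB closed =
      trans (≡.sym (parity-++ x A B))
            (closedWalk-parity x (A ++ B) (Walk-++ A walkA walkB) (trans (end-++ x A B) closed))

    tree-switching : Connected T → (root : Fin n) → ∃ λ s → ∀ u v → E T u v → s u xor s v ≡ e u v
    tree-switching connected root = s , s-switches
      where
      from : ∀ v → ∃ λ vs → Walk T root vs × end root vs ≡ v
      from v = Reach⇒Walk (connected root v)
      to : ∀ v → ∃ λ vs → Walk T v vs × end v vs ≡ root
      to v = Reach⇒Walk (connected v root)
      s : Fin n → Bool
      s v = parity root (proj₁ (from v))
      s′ : Fin n → Bool
      s′ v = parity v (proj₁ (to v))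
      s′≡s : ∀ v → s′ v ≡ s v
      s′≡s v with from v | to v
      ... | A , walkA , endA | B , walkB , endB = ≡.sym (xor≡false⇒≡ (closedWalk-++ A B walkA endA walkB endB))
      s-switches : ∀ u v → E T u v → s u xor s v ≡ e u v
      s-switches u v uv with from u | to v | s′≡s v
      ... | A , walkA , endA | B , walkB , endB | s′v≡sv = xor-cancel (parity root A) (e u v) (s v)
        (trans (cong (λ z → parity root A xor (e u v xor z)) (≡.sym s′v≡sv))
               (closedWalk-++ A (v ∷ B) walkA endA (uv ∷ walkB) endB))

nth : ∀ {N} (p : Subset N) → Fin ∣ p ∣ → Fin N
nth (true ∷ p) fz = fz
nth (true ∷ p) (fs i) = fs (nth p i)
nth (false ∷ p) i = fs (nth p i)

nth-∈ : ∀ {N} (p : Subset N) i → nth p i ∈ₛ p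
nth-∈ (true ∷ p) fz = here
nth-∈ (true ∷ p) (fs i) = there (nth-∈ p i)
nth-∈ (false ∷ p) i = there (nth-∈ p i)

nth-injective : ∀ {N} (p : Subset N) i j → nth p i ≡ nth p j → i ≡ j
nth-injective (true ∷ p) fz fz eq = refl
nth-injective (true ∷ p) (fs i) (fs j) eq = cong fs (nth-injective p i j (Finₚ.suc-injective eq))
nth-injective (false ∷ p) i j eq = nth-injective p i j (Finₚ.suc-injective eq)

image : ∀ {n N} → (Fin n → Fin N) → Subset N
image {zero} f = ∅
image {suc n} f = ⁅ f fz ⁆ ∪ image (f ∘ fs)

∈-image : ∀ {n N} (f : Fin n → Fin N) {x} → x ∈ₛ image f → ∃ λ u → f u ≡ x
∈-image {zero} f x∈ = ⊥-elim (Subsetₚ.∉⊥ x∈)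
∈-image {suc n} f x∈ with Subsetₚ.x∈p∪q⁻ ⁅ f fz ⁆ (image (f ∘ fs)) x∈
... | inj₁ x∈⁅f0⁆ = fz , ≡.sym (Subsetₚ.x∈⁅y⁆⇒x≡y (f fz) x∈⁅f0⁆)
... | inj₂ x∈rest with ∈-image (f ∘ fs) x∈rest
... | u , fu≡x = fs u , fu≡x

∣⁅x⁆∪p∣ : ∀ {N} (x : Fin N) (p : Subset N) → x ∉ₛ p → ∣ ⁅ x ⁆ ∪ p ∣ ≡ suc ∣ p ∣
∣⁅x⁆∪p∣ fz (true ∷ p) x∉p = ⊥-elim (x∉p here)
∣⁅x⁆∪p∣ fz (false ∷ p) x∉p = cong (λ q → suc ∣ q ∣) (Subsetₚ.∪-identityˡ p)
∣⁅x⁆∪p∣ (fs x) (true ∷ p) x∉p = cong suc (∣⁅x⁆∪p∣ x p (x∉p ∘ there))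
∣⁅x⁆∪p∣ (fs x) (false ∷ p) x∉p = ∣⁅x⁆∪p∣ x p (x∉p ∘ there)

∣image∣ : ∀ {n N} (f : Fin n → Fin N) → Injective _≡_ _≡_ f → ∣ image f ∣ ≡ n
∣image∣ {zero} {N} f injective = Subsetₚ.∣⊥∣≡0 N
∣image∣ {suc n} f injective = trans (∣⁅x⁆∪p∣ (f fz) (image (f ∘ fs)) f0∉)
  (cong suc (∣image∣ (f ∘ fs) (Finₚ.suc-injective ∘ injective)))
  where
  f0∉ : f fz ∉ₛ image (f ∘ fs)
  f0∉ f0∈ with ∈-image (f ∘ fs) f0∈
  ... | u , fu≡f0 with injective fu≡f0
  ... | ()

-- DP-colourings from non-vanishing points

∈-pairs : ∀ {n} {i j : Fin n} → toℕ i < toℕ j → (i , j) ∈ pairs n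
∈-pairs {n} {i} {j} i<j =
  ∈-concatMap⁺ _ (Any.map (λ { refl → ∈-concatMap⁺ _ (Any.map (λ { refl → ∈-if }) (∈-allFin j)) }) (∈-allFin i))
  where
  ∈-if : (i , j) ∈ (if toℕ i <ᵇ toℕ j then [ (i , j) ] else [])
  ∈-if rewrite Equivalence.to Boolₚ.T-≡ (ℕₚ.<⇒<ᵇ i<j) = here refl

≮⇒<ᵇ≡false : ∀ {m n} → ¬ m < n → (m <ᵇ n) ≡ false
≮⇒<ᵇ≡false {m} {n} m≮n = Boolₚ.¬-not (λ m<ᵇn → m≮n (ℕₚ.<ᵇ⇒< m n (Equivalence.from Boolₚ.T-≡ m<ᵇn)))

symmetrize : ∀ {n} {A : Set} → (Fin n → Fin n → A) → Fin n → Fin n → A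
symmetrize f u v = if toℕ u <ᵇ toℕ v then f u v else f v u

symmetrize-< : ∀ {n} {A : Set} (f : Fin n → Fin n → A) {u v} → toℕ u < toℕ v → symmetrize f u v ≡ f u v
symmetrize-< f u<v rewrite Equivalence.to Boolₚ.T-≡ (ℕₚ.<⇒<ᵇ u<v) = refl

symmetrize-sym : ∀ {n} {A : Set} (f : Fin n → Fin n → A) u v → symmetrize f u v ≡ symmetrize f v u
symmetrize-sym f u v with Finₚ.<-cmp u v
... | tri< u<v _ v≮u rewrite symmetrize-< f u<v | ≮⇒<ᵇ≡false v≮u = refl
... | tri≈ _ refl _ = refl
... | tri> u≮v _ v<u rewrite symmetrize-< f v<u | ≮⇒<ᵇ≡false u≮v = refl

decidable-choice : ∀ {A : Set} {P : A → Set} → A → ∀ b → (b ≡ true → Σ A P) → Σ A λ a → b ≡ true → P a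
decidable-choice a₀ true choose = proj₁ (choose refl) , λ _ → proj₂ (choose refl)
decidable-choice a₀ false choose = a₀ , λ ()

if-edge : ∀ {A : Set} (bT bG : Bool) {p q r : A} → (bT ≡ true → p ≡ q) → bG ≡ true →
          (if bT then p else if bG then q else r) ≡ q
if-edge true bG p≡q _ = p≡q refl
if-edge false true _ _ = refl

factor-leading : ∀ {n} (bT bG : Bool) {p q : Poly n} k → Homogeneous 1 p → Homogeneous 1 q →
  let f = if bT then p else if bG then q else oneP in
  ∃ λ d → LeadingForm d f (λ a → evalP f a +₃ (if bG then k else zero₃))
factor-leading true bG k homP homQ = 1 , LeadingForm-+const _ homP (inj₂ (s≤s z≤n))
factor-leading false true k homP homQ = 1 , LeadingForm-+const k homQ (inj₂ (s≤s z≤n))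
factor-leading {n} false false k homP homQ = 0 , LeadingForm-+const zero₃ (deg-replicate-0 n ∷ []) (inj₁ refl)

module DPColouring {n} (G T : Graph n) (C : Cover G) (threeFold : IsFold C 3) where

  label : Fin n → F3 → Fin (N C)
  label u x = nth (L C u) (subst Fin (≡.sym (threeFold u)) x)

  label-∈ : ∀ u x → label u x ∈ₛ L C u
  label-∈ u x = nth-∈ (L C u) (subst Fin (≡.sym (threeFold u)) x)

  label-injective : ∀ u x y → label u x ≡ label u y → x ≡ y
  label-injective u x y eq = ≡ₚ.subst-injective (≡.sym (threeFold u)) (nth-injective (L C u) _ _ eq)

  conflict : Fin n → Fin n → Rel₃
  conflict u v x y = Adj (H C) (label u x) (label v y)

  conflict-matching : ∀ u v → E G u v → IsMatching (conflict u v)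
  conflict-matching u v uv =
    (λ x y y′ h h′ → label-injective v y y′
       (matchingˡ C u v uv (label u x) (label v y) (label v y′) (label-∈ u x) (label-∈ v y) (label-∈ v y′) h h′)) ,
    (λ x x′ y h h′ → label-injective u x x′
       (matchingʳ C u v uv (label u x) (label u x′) (label v y) (label-∈ u x) (label-∈ u x′) (label-∈ v y) h h′))

  affine : ∀ u v → Σ (Bool × F3) λ εc → E G u v → WithinAffine (proj₁ εc) (proj₂ εc) (conflict u v)
  affine u v = decidable-choice (true , zero₃) (Adj G u v) λ uv →
    let ε , c , within = matching⇒affine (conflict u v) (conflict-matching u v uv) in (ε , c) , within

  ε : Fin n → Fin n → Bool
  ε u v = proj₁ (proj₁ (affine u v))

  c : Fin n → Fin n → F3
  c u v = proj₂ (proj₁ (affine u v))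

  module _ (T-connected : Connected T) (T-acyclic : ¬ HasCycle T) (root : Fin n) where

    open Parity (symmetrize (λ u v → not (ε u v))) (symmetrize-sym (λ u v → not (ε u v)))

    s : Fin n → Bool
    s = proj₁ (tree-switching T-acyclic T-connected root)

    s-tree : ∀ i j → toℕ i < toℕ j → E T i j → s i xor s j ≡ not (ε i j)
    s-tree i j i<j ij =
      trans (proj₂ (tree-switching T-acyclic T-connected root) i j ij) (symmetrize-< (λ u v → not (ε u v)) i<j)

    b : Fin n → Fin n → Bool
    b i j = not (ε i j xor (s i xor s j))

    b-tree : ∀ i j → toℕ i < toℕ j → E T i j → sign (b i j) ≡ minusOne₃
    b-tree i j i<j ij = cong (λ z → sign (not (ε i j xor z))) (s-tree i j i<j ij)
      ⟨ trans ⟩ cong (sign ∘ not) (Boolₚ.xor-inverseʳ (ε i j))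

    κ : Fin n → Fin n → F3
    κ i j = sign (ε i j) *₃ (sign (s i) *₃ c i j)

    k : Fin n → Fin n → F3
    k i j = if Adj G i j then κ i j else zero₃

    φ : Fin n × Fin n → Vec F3 n → F3
    φ (i , j) a = evalP (factor G T b i j) a +₃ k i j

    φ-leading : ∀ ij → ∃ λ d → LeadingForm d (uncurry (factor G T b) ij) (φ ij)
    φ-leading (i , j) = factor-leading (Adj T i j) (Adj G i j) (κ i j)
      (Homogeneous-linearForm i minusOne₃ j) (Homogeneous-linearForm i (sign (b i j)) j)

    fPoly-∏ : fPoly G T b ≡ ∏ᴾ (uncurry (factor G T b)) (pairs n)
    fPoly-∏ = Listₚ.foldr-cong (λ _ _ → refl) refl (pairs n)

    colour : Vec F3 n → Fin n → Fin (N C)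
    colour a u = label u (sign (s u) *₃ Vec.lookup a u)

    conflict⇒φ≡0 : ∀ a i j → toℕ i < toℕ j → E G i j →
                   Adj (H C) (colour a i) (colour a j) ≡ true → φ (i , j) a ≡ zero₃
    conflict⇒φ≡0 a i j i<j ij conflicting = begin
      evalP (factor G T b i j) a +₃ k i j
        ≡⟨ cong₂ (λ f κ → evalP f a +₃ κ)
             (if-edge (Adj T i j) (Adj G i j) (λ ijT → cong (λ σ → linearForm i σ j) (≡.sym (b-tree i j i<j ijT))) ij)
             (cong (λ bG → if bG then κ i j else zero₃) ij) ⟩
      evalP (linearForm i (sign (b i j)) j) a +₃ κ i j
        ≡⟨ cong (_+₃ κ i j) (evalP-linearForm i (sign (b i j)) j a) ⟩
      (aᵢ +₃ (sign (b i j) *₃ aⱼ)) +₃ κ i j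
        ≡⟨ sign-affine⇒linear (ε i j) (s i) (s j) aᵢ aⱼ (c i j)
             (proj₂ (affine i j) ij (sign (s i) *₃ aᵢ) (sign (s j) *₃ aⱼ) conflicting) ⟩
      zero₃ ∎
      where
      open ≡-Reasoning
      aᵢ = Vec.lookup a i
      aⱼ = Vec.lookup a j

    no-conflict : ∀ a → ∏ᶠ φ (pairs n) a ≢ zero₃ → ∀ u v → Adj (H C) (colour a u) (colour a v) ≢ true
    no-conflict a ∏≢0 u v conflicting =
      [ same , adjacent ]′ (cross C u v (colour a u) (colour a v) (label-∈ u _) (label-∈ v _) conflicting)
      where
      ordered : ∀ i j → toℕ i < toℕ j → E G i j → Adj (H C) (colour a i) (colour a j) ≢ true
      ordered i j i<j ij = ∏ᶠ-≢0 φ (pairs n) a ∏≢0 (∈-pairs i<j) ∘ conflict⇒φ≡0 a i j i<j ij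
      same : u ≢ v
      same refl = E-irrefl (H C) (colour a u) conflicting
      adjacent : ¬ E G u v
      adjacent uv = compare (Finₚ.<-cmp u v)
        where
        compare : Tri (toℕ u < toℕ v) (u ≡ v) (toℕ v < toℕ u) → ⊥
        compare (tri< u<v _ _) = ordered u v u<v uv conflicting
        compare (tri≈ _ u≡v _) = E-irrefl G u (subst (E G u) (≡.sym u≡v) uv)
        compare (tri> _ _ v<u) = ordered v u v<u (trans (Graph.sym G v u) uv)
                                   (trans (Graph.sym (H C) (colour a v) (colour a u)) conflicting)

    colouring : (∀ b → ∃ λ (t : Vec (Fin 3) n) → coeff (fPoly G T b) (map toℕ t) ≢ zero₃) → HasColoring C
    colouring hyp = image (colour a) , ∣image∣ (colour a) colour-injective , image-independent
      where
      t = proj₁ (hyp b)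
      point = LeadingForm-nonvanishing (proj₂ (LeadingForm-∏ φ-leading (pairs n))) t
                (subst (λ f → coeff f (map toℕ t) ≢ zero₃) fPoly-∏ (proj₂ (hyp b)))
      a = proj₁ point
      colour-injective : Injective _≡_ _≡_ (colour a)
      colour-injective {u} {v} eq =
        disjoint C (colour a u) u v (label-∈ u _) (subst (_∈ₛ L C v) (≡.sym eq) (label-∈ v _))
      image-independent : ∀ x y → x ∈ₛ image (colour a) → y ∈ₛ image (colour a) → Adj (H C) x y ≡ false
      image-independent x y x∈ y∈ =
        let u , ux = ∈-image (colour a) x∈
            v , vy = ∈-image (colour a) y∈
        in subst₂ (λ x y → Adj (H C) x y ≡ false) ux vy (Boolₚ.¬-not (no-conflict a (proj₂ point) u v))

corollary3p3 : ∀ {n : ℕ} (G T : Graph n) → Connected G → HasCycle G → IsSpanningTree T G →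
    (∀ (b : Fin n → Fin n → Bool) → ∃ λ (t : Vec (Fin 3) n) → ¬ coeff (fPoly G T b) (map toℕ t) ≡ zero₃) →
    χDP≤ G 3
corollary3p3 G T _ (_ , cycle , _) (_ , T-connected , T-acyclic) hyp =
  3 , ℕₚ.≤-refl , λ C threeFold → DPColouring.colouring G T C threeFold T-connected T-acyclic (cycle fz) hyp
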